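{- Let $f:\{0,1\}^*\to\{0,1\}^*$ be the morphism $f(0)=001$, $f(1)=110$; let $h:\Sigma_4^*\to\Sigma_4^*$ (with $\Sigma_4=\{0,1,2,3\}$) be the morphism $h(0)=012$, $h(1)=302$, $h(2)=031$, $h(3)=321$; and let $g_1,g_2:\Sigma_4^*\to\{0,1\}^*$ be the morphisms $g_1(0)=001$, $g_1(1)=101$, $g_1(2)=010$, $g_1(3)=110$ and $g_2(0)=010$, $g_2(1)=100$, $g_2(2)=011$, $g_2(3)=101$. Then $$f^\omega(0)=g_2(h^\omega(0))\,\mathrm{SH}\,g_1(h^\omega(0)).$$
   Context: For a morphism $\varphi$ with $\varphi(0)$ beginning with $0$, $\varphi^\omega(0)$ denotes the infinite fixed point $\lim_n\varphi^n(0)$. For infinite words $a_1a_2\cdots$ and $b_1b_2\cdots$, the perfect shuffle is $a_1a_2\cdots\,\mathrm{SH}\,b_1b_2\cdots=a_1b_1a_2b_2\cdots$. -}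

module Defs where

open import Data.Nat using (ℕ; zero; suc; _*_; _+_; _/_; _%_)
open import Data.Fin using (Fin; zero; suc)
open import Data.List using (List; []; _∷_; _++_; concatMap; take; length)
open import Data.Vec using (Vec; lookup; toList; []; _∷_)
open import Data.Nat.DivMod using (m%n<n)
import Data.Fin
open import Data.Product using (Σ; _×_; _,_)
open import Relation.Binary.PropositionalEquality using (_≡_)

Word : Set → Set
Word A = ℕ → A

prefix : {A : Set} → Word A → ℕ → List A
prefix w zero = []
prefix w (suc n) = prefix w n ++ (w n ∷ [])

apply : {A B : Set} → (A → List B) → List A → List B
apply φ = concatMap φ

iter : {A : Set} → ℕ → (A → List A) → List A → List A
iter zero φ u = u
iter (suc n) φ u = apply φ (iter n φ u)

-- w is the fixed point φ^ω(a) = lim_n φ^n(a): every φ^n(a) is a prefix of w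
-- (for the growing morphisms below this determines w uniquely)
IsFixedPoint : {A : Set} → (A → List A) → A → Word A → Set
IsFixedPoint φ a w = (n : ℕ) → prefix w (length (iter n φ (a ∷ []))) ≡ iter n φ (a ∷ [])

apply∞ : {A B : Set} → (A → Vec B 3) → Word A → Word B
apply∞ φ w n = lookup (φ (w (n / 3))) (Data.Fin.fromℕ< (m%n<n n 3))

shuffle : {A : Set} → Word A → Word A → Word A
shuffle a b n with n % 2
... | zero = a (n / 2)
... | suc _ = b (n / 2)

Σ₂ : Set
Σ₂ = Fin 2

Σ₄ : Set
Σ₄ = Fin 4

pattern 𝟎 = zero
pattern 𝟏 = suc zero
pattern 𝟐 = suc (suc zero)
pattern 𝟑 = suc (suc (suc zero))

fV : Σ₂ → Vec Σ₂ 3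
fV 𝟎 = 𝟎 ∷ 𝟎 ∷ 𝟏 ∷ []
fV 𝟏 = 𝟏 ∷ 𝟏 ∷ 𝟎 ∷ []

hV : Σ₄ → Vec Σ₄ 3
hV 𝟎 = 𝟎 ∷ 𝟏 ∷ 𝟐 ∷ []
hV 𝟏 = 𝟑 ∷ 𝟎 ∷ 𝟐 ∷ []
hV 𝟐 = 𝟎 ∷ 𝟑 ∷ 𝟏 ∷ []
hV 𝟑 = 𝟑 ∷ 𝟐 ∷ 𝟏 ∷ []

g₁ : Σ₄ → Vec Σ₂ 3
g₁ 𝟎 = 𝟎 ∷ 𝟎 ∷ 𝟏 ∷ []
g₁ 𝟏 = 𝟏 ∷ 𝟎 ∷ 𝟏 ∷ []
g₁ 𝟐 = 𝟎 ∷ 𝟏 ∷ 𝟎 ∷ []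
g₁ 𝟑 = 𝟏 ∷ 𝟏 ∷ 𝟎 ∷ []

g₂ : Σ₄ → Vec Σ₂ 3
g₂ 𝟎 = 𝟎 ∷ 𝟏 ∷ 𝟎 ∷ []
g₂ 𝟏 = 𝟏 ∷ 𝟎 ∷ 𝟎 ∷ []
g₂ 𝟐 = 𝟎 ∷ 𝟏 ∷ 𝟏 ∷ []
g₂ 𝟑 = 𝟏 ∷ 𝟎 ∷ 𝟏 ∷ []

f : Σ₂ → List Σ₂
f a = toList (fV a)

h : Σ₄ → List Σ₄
h a = toList (hV a)

-- Read a binary word two letters at a time and let c ∈ Σ₄ stand for the pair (low c , high c),
-- i.e. c = low c + 2 · high c. Under this coding f becomes h: f (bits c) = bits (h c). Hence if
-- H = h(H), the shuffle S of low ∘ H and high ∘ H satisfies f (S[0,2m)) = S[0,6m), so S and F = f(F)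
-- both have f^k(00) as prefix of length 2·3^k, and they coincide. Letterwise g₂ = low ∘ h and
-- g₁ = high ∘ h, so low ∘ H = g₂(H) and high ∘ H = g₁(H). The fixed points themselves exist as
-- pointwise limits of φ^k applied to the constant word a, whose n-th letter is settled after n steps.
module Submission where

open import Defs
open import Data.Nat using (ℕ; zero; suc; _+_; _*_; _^_; _≤_; _<_; z≤n; s≤s; z<s; s≤s⁻¹; _/_; _%_)
open import Data.Nat.Properties
  using (≤-refl; ≤-trans; ≤-<-trans; <-≤-trans; m<1+n⇒m<n∨m≡n; *-comm; m≤m*n; m<m*n; m^n≢0)
open import Data.Nat.DivMod
  using (m%n<n; m/n<m; m*n/n≡m; m*n%n≡0; [m+kn]%n≡m%n; +-distrib-/-∣ʳ; m<n⇒m%n≡m; m<n⇒m/n≡0)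
open import Data.Nat.Tactic.RingSolver using (solve-∀)
open import Data.Nat.Divisibility using (divides-refl)
open import Data.Fin using (Fin; zero; suc; toℕ; fromℕ<)
open import Data.Fin.Properties using (toℕ<n; fromℕ<-cong; fromℕ<-toℕ)
open import Data.List using (List; []; _∷_; _++_; length)
open import Data.List.Properties
  using (∷ʳ-injective; concatMap-++; length-++; ∷-injectiveˡ; ++-assoc; ++-identityʳ)
open import Data.Vec using (Vec; []; _∷_; lookup; toList; map)
open import Data.Vec.Properties using (lookup-map; length-toList)
open import Data.Sum using (inj₁; inj₂)
open import Data.Product using (Σ; _×_; _,_)
open import Function using (_∘_; _∋_)
open import Relation.Binary.PropositionalEquality

n<3^n : ∀ n → n < 3 ^ n
n<3^n zero = z<s
n<3^n (suc n) =
  ≤-<-trans (n<3^n n) (subst (3 ^ n <_) (*-comm (3 ^ n) 3) (m<m*n (3 ^ n) 3 {{m^n≢0 3 n}} (s≤s (s≤s z≤n))))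

module _ {A : Set} where

  prefix-cong : {u v : Word A} → u ≗ v → ∀ n → prefix u n ≡ prefix v n
  prefix-cong u≗v zero = refl
  prefix-cong u≗v (suc n) = cong₂ (λ xs x → xs ++ x ∷ []) (prefix-cong u≗v n) (u≗v n)

  prefix-injective : {u v : Word A} → ∀ n {i} → i < n → prefix u n ≡ prefix v n → u i ≡ v i
  prefix-injective {u} {v} (suc n) i<1+n eq
    with ∷ʳ-injective (prefix u n) (prefix v n) eq | m<1+n⇒m<n∨m≡n i<1+n
  ... | prefixes , _ | inj₁ i<n = prefix-injective n i<n prefixes
  ... | _ , lasts | inj₂ refl = lasts

  shuffle-cong : {a a′ b b′ : Word A} → a ≗ a′ → b ≗ b′ → shuffle a b ≗ shuffle a′ b′
  shuffle-cong a≗a′ b≗b′ n with n % 2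
  ... | zero = a≗a′ (n / 2)
  ... | suc _ = b≗b′ (n / 2)

  shuffle-even : (a b : Word A) (m : ℕ) → shuffle a b (m * 2) ≡ a m
  shuffle-even a b m rewrite m * 2 % 2 ≡ 0 ∋ m*n%n≡0 m 2 = cong a (m*n/n≡m m 2)

  shuffle-odd : (a b : Word A) (m : ℕ) → shuffle a b (suc (m * 2)) ≡ b m
  shuffle-odd a b m rewrite suc (m * 2) % 2 ≡ 1 ∋ [m+kn]%n≡m%n 1 m 2 =
    cong b (trans (+-distrib-/-∣ʳ 1 {d = 2} (divides-refl m)) (m*n/n≡m m 2))

  prefix-+ : (w : Word A) (n k : ℕ) → prefix w (k + n) ≡ prefix w n ++ prefix (λ i → w (i + n)) k
  prefix-+ w n zero = sym (++-identityʳ (prefix w n))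
  prefix-+ w n (suc k) = begin
    prefix w (k + n) ++ w (k + n) ∷ []                              ≡⟨ cong (_++ w (k + n) ∷ []) (prefix-+ w n k) ⟩
    (prefix w n ++ prefix (λ i → w (i + n)) k) ++ w (k + n) ∷ []    ≡⟨ ++-assoc (prefix w n) _ _ ⟩
    prefix w n ++ prefix (λ i → w (i + n)) k ++ w (k + n) ∷ []      ∎
    where open ≡-Reasoning

  prefix-shuffle : {C : Set} (p q : C → A) (w : Word C) (m : ℕ) →
    prefix (shuffle (p ∘ w) (q ∘ w)) (m * 2) ≡ apply (λ c → p c ∷ q c ∷ []) (prefix w m)
  prefix-shuffle p q w zero = refl
  prefix-shuffle p q w (suc m) = begin
    (prefix s (m * 2) ++ s (m * 2) ∷ []) ++ s (suc (m * 2)) ∷ []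
      ≡⟨ ++-assoc (prefix s (m * 2)) _ _ ⟩
    prefix s (m * 2) ++ s (m * 2) ∷ s (suc (m * 2)) ∷ []
      ≡⟨ cong₂ _++_ (prefix-shuffle p q w m)
                    (cong₂ (λ x y → x ∷ y ∷ []) (shuffle-even _ _ m) (shuffle-odd _ _ m)) ⟩
    apply δ (prefix w m) ++ apply δ (w m ∷ [])
      ≡⟨ concatMap-++ δ (prefix w m) (w m ∷ []) ⟨
    apply δ (prefix w m ++ w m ∷ []) ∎
    where
    open ≡-Reasoning
    s = shuffle (p ∘ w) (q ∘ w)
    δ = λ c → p c ∷ q c ∷ []

  prefix-iterate : (φ : A → List A) (w : Word A) (N : ℕ → ℕ) →
    (∀ k → apply φ (prefix w (N k)) ≡ prefix w (N (suc k))) →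
    ∀ k → prefix w (N k) ≡ iter k φ (prefix w (N 0))
  prefix-iterate φ w N step zero = refl
  prefix-iterate φ w N step (suc k) = trans (sym (step k)) (cong (apply φ) (prefix-iterate φ w N step k))

  ≗-from-tower : (φ : A → List A) (N : ℕ → ℕ) → (∀ k → k < N k) → {u v : Word A} →
    (∀ k → apply φ (prefix u (N k)) ≡ prefix u (N (suc k))) →
    (∀ k → apply φ (prefix v (N k)) ≡ prefix v (N (suc k))) →
    prefix u (N 0) ≡ prefix v (N 0) → u ≗ v
  ≗-from-tower φ N k<N {u} {v} u-step v-step seed i = prefix-injective (N i) (k<N i) (begin
    prefix u (N i)              ≡⟨ prefix-iterate φ u N u-step i ⟩
    iter i φ (prefix u (N 0))   ≡⟨ cong (iter i φ) seed ⟩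
    iter i φ (prefix v (N 0))   ≡⟨ prefix-iterate φ v N v-step i ⟨
    prefix v (N i)              ∎)
    where open ≡-Reasoning

apply-intertwine : {A B : Set} (φ : B → List B) (ψ : A → List A) (δ : A → List B) →
  (∀ c → apply φ (δ c) ≡ apply δ (ψ c)) → ∀ u → apply φ (apply δ u) ≡ apply δ (apply ψ u)
apply-intertwine φ ψ δ φδ≡δψ [] = refl
apply-intertwine φ ψ δ φδ≡δψ (c ∷ u) = begin
  apply φ (δ c ++ apply δ u)             ≡⟨ concatMap-++ φ (δ c) (apply δ u) ⟩
  apply φ (δ c) ++ apply φ (apply δ u)   ≡⟨ cong₂ _++_ (φδ≡δψ c) (apply-intertwine φ ψ δ φδ≡δψ u) ⟩
  apply δ (ψ c) ++ apply δ (apply ψ u)   ≡⟨ concatMap-++ δ (ψ c) (apply ψ u) ⟨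
  apply δ (ψ c ++ apply ψ u)             ∎
  where open ≡-Reasoning

module Uniform {A B : Set} (φV : A → Vec B 3) where

  φ : A → List B
  φ = toList ∘ φV

  length-apply : ∀ u → length (apply φ u) ≡ length u * 3
  length-apply [] = refl
  length-apply (c ∷ u) = trans (length-++ (φ c)) (cong₂ _+_ (length-toList (φV c)) (length-apply u))

  apply∞-block : (w : Word A) (m : ℕ) (r : Fin 3) → apply∞ φV w (toℕ r + m * 3) ≡ lookup (φV (w m)) r
  apply∞-block w m r = cong₂ (λ q i → lookup (φV (w q)) i) quotient remainder
    where
    quotient : (toℕ r + m * 3) / 3 ≡ m
    quotient = trans (+-distrib-/-∣ʳ (toℕ r) {d = 3} (divides-refl m))
                     (cong₂ _+_ (m<n⇒m/n≡0 (toℕ<n r)) (m*n/n≡m m 3))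
    remainder : fromℕ< (m%n<n (toℕ r + m * 3) 3) ≡ r
    remainder = trans (fromℕ<-cong _ _ (trans ([m+kn]%n≡m%n (toℕ r) m 3) (m<n⇒m%n≡m (toℕ<n r))) _ (toℕ<n r))
                      (fromℕ<-toℕ r _)

  apply∞-local : (u v : Word A) (n : ℕ) → u (n / 3) ≡ v (n / 3) → apply∞ φV u n ≡ apply∞ φV v n
  apply∞-local u v n = cong (λ x → lookup (φV x) (fromℕ< (m%n<n n 3)))

  prefix-apply∞ : (w : Word A) (m : ℕ) → prefix (apply∞ φV w) (m * 3) ≡ apply φ (prefix w m)
  prefix-apply∞ w zero = refl
  prefix-apply∞ w (suc m) = begin
    prefix w′ (3 + m * 3)                                 ≡⟨ prefix-+ w′ (m * 3) 3 ⟩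
    prefix w′ (m * 3) ++ prefix (λ i → w′ (i + m * 3)) 3
      ≡⟨ cong₂ _++_ (prefix-apply∞ w m) (block (φV (w m)) (apply∞-block w m)) ⟩
    apply φ (prefix w m) ++ apply φ (w m ∷ [])            ≡⟨ concatMap-++ φ (prefix w m) (w m ∷ []) ⟨
    apply φ (prefix w m ++ w m ∷ [])                      ∎
    where
    open ≡-Reasoning
    w′ = apply∞ φV w
    block : (v : Vec B 3) → (∀ r → w′ (toℕ r + m * 3) ≡ lookup v r) →
      prefix (λ i → w′ (i + m * 3)) 3 ≡ toList v ++ []
    block (x ∷ y ∷ z ∷ []) w′≡v =
      cong₂ _∷_ (w′≡v zero) (cong₂ _∷_ (w′≡v (suc zero)) (cong₂ _∷_ (w′≡v (suc (suc zero))) refl))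

apply∞-factor : {A B : Set} (φV : A → Vec A 3) (π : A → B) (ψV : A → Vec B 3) →
  (∀ c → ψV c ≡ map π (φV c)) → {w : Word A} → w ≗ apply∞ φV w → π ∘ w ≗ apply∞ ψV w
apply∞-factor φV π ψV ψ≡πφ {w} w≗φw n = begin
  π (w n)                               ≡⟨ cong π (w≗φw n) ⟩
  π (lookup (φV (w (n / 3))) r)         ≡⟨ lookup-map r π (φV (w (n / 3))) ⟨
  lookup (map π (φV (w (n / 3)))) r     ≡⟨ cong (λ v → lookup v r) (ψ≡πφ (w (n / 3))) ⟨
  lookup (ψV (w (n / 3))) r             ∎
  where
  open ≡-Reasoning
  r = fromℕ< (m%n<n n 3)

module FixedPoint {A : Set} (φV : A → Vec A 3) (a : A) where
  open Uniform φV

  iterLength : ℕ → ℕ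
  iterLength k = length (iter k φ (a ∷ []))

  prefix-apply : {w : Word A} → w ≗ apply∞ φV w → ∀ m → apply φ (prefix w m) ≡ prefix w (m * 3)
  prefix-apply {w} w≗φw m = trans (sym (prefix-apply∞ w m)) (sym (prefix-cong w≗φw (m * 3)))

  iterLength≡3^ : ∀ k → iterLength k ≡ 3 ^ k
  iterLength≡3^ zero = refl
  iterLength≡3^ (suc k) =
    trans (length-apply (iter k φ (a ∷ []))) (trans (cong (_* 3) (iterLength≡3^ k)) (*-comm (3 ^ k) 3))

  isFixedPoint⇒≗apply∞ : {w : Word A} → IsFixedPoint φ a w → w ≗ apply∞ φV w
  isFixedPoint⇒≗apply∞ {w} fp i = prefix-injective (L i * 3) i<3L (begin
    prefix w (L i * 3)              ≡⟨ cong (prefix w) (length-apply (iter i φ (a ∷ []))) ⟨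
    prefix w (L (suc i))            ≡⟨ fp (suc i) ⟩
    apply φ (iter i φ (a ∷ []))     ≡⟨ cong (apply φ) (fp i) ⟨
    apply φ (prefix w (L i))        ≡⟨ prefix-apply∞ w (L i) ⟨
    prefix (apply∞ φV w) (L i * 3)  ∎)
    where
    open ≡-Reasoning
    L = iterLength
    i<3L : i < L i * 3
    i<3L = <-≤-trans (subst (i <_) (sym (iterLength≡3^ i)) (n<3^n i)) (m≤m*n (L i) 3)

  ≗apply∞⇒isFixedPoint : {w : Word A} → w 0 ≡ a → w ≗ apply∞ φV w → IsFixedPoint φ a w
  ≗apply∞⇒isFixedPoint {w} w0≡a w≗φw k =
    trans (prefix-iterate φ w L step k) (cong (λ x → iter k φ (x ∷ [])) w0≡a)
    where
    L = iterLength
    step : ∀ k → apply φ (prefix w (L k)) ≡ prefix w (L (suc k))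
    step k = trans (prefix-apply w≗φw (L k)) (cong (prefix w) (sym (length-apply (iter k φ (a ∷ [])))))

  module Construction (φa-starts-with-a : lookup (φV a) zero ≡ a) where

    approx : ℕ → Word A
    approx zero = λ _ → a
    approx (suc k) = apply∞ φV (approx k)

    approx-zero : ∀ k → approx k 0 ≡ a
    approx-zero zero = refl
    approx-zero (suc k) = trans (cong (λ x → lookup (φV x) zero) (approx-zero k)) φa-starts-with-a

    suc[n]/3≤n : ∀ n → suc n / 3 ≤ n
    suc[n]/3≤n n = s≤s⁻¹ (m/n<m (suc n) 3 (s≤s (s≤s z≤n)))

    approx-stable : ∀ {j k} n → n ≤ j → n ≤ k → approx j n ≡ approx k n
    approx-stable {j} {k} zero _ _ = trans (approx-zero j) (sym (approx-zero k))
    approx-stable {suc j} {suc k} (suc n) (s≤s n≤j) (s≤s n≤k) =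
      apply∞-local (approx j) (approx k) (suc n)
        (approx-stable (suc n / 3) (≤-trans (suc[n]/3≤n n) n≤j) (≤-trans (suc[n]/3≤n n) n≤k))

    fixedWord : Word A
    fixedWord n = approx n n

    fixedWord-≗apply∞ : fixedWord ≗ apply∞ φV fixedWord
    fixedWord-≗apply∞ zero = sym φa-starts-with-a
    fixedWord-≗apply∞ (suc n) =
      apply∞-local (approx n) fixedWord (suc n) (approx-stable (suc n / 3) (suc[n]/3≤n n) ≤-refl)

    fixedWord-isFixedPoint : IsFixedPoint φ a fixedWord
    fixedWord-isFixedPoint = ≗apply∞⇒isFixedPoint refl fixedWord-≗apply∞

low high : Σ₄ → Σ₂
low 𝟎 = 𝟎
low 𝟏 = 𝟏
low 𝟐 = 𝟎
low 𝟑 = 𝟏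
high 𝟎 = 𝟎
high 𝟏 = 𝟎
high 𝟐 = 𝟏
high 𝟑 = 𝟏

bits : Σ₄ → List Σ₂
bits c = low c ∷ high c ∷ []

f-bits≡bits-h : ∀ c → apply f (bits c) ≡ apply bits (h c)
f-bits≡bits-h 𝟎 = refl
f-bits≡bits-h 𝟏 = refl
f-bits≡bits-h 𝟐 = refl
f-bits≡bits-h 𝟑 = refl

g₂≡low-h : ∀ c → g₂ c ≡ map low (hV c)
g₂≡low-h 𝟎 = refl
g₂≡low-h 𝟏 = refl
g₂≡low-h 𝟐 = refl
g₂≡low-h 𝟑 = refl

g₁≡high-h : ∀ c → g₁ c ≡ map high (hV c)
g₁≡high-h 𝟎 = refl
g₁≡high-h 𝟏 = refl
g₁≡high-h 𝟐 = refl
g₁≡high-h 𝟑 = refl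

module f^ω = FixedPoint fV 𝟎
module h^ω = FixedPoint hV 𝟎

f^ω≗shuffle-h^ω : {F : Word Σ₂} {H : Word Σ₄} → IsFixedPoint f 𝟎 F → IsFixedPoint h 𝟎 H →
  F ≗ shuffle (low ∘ H) (high ∘ H)
f^ω≗shuffle-h^ω {F} {H} F-fixed H-fixed = ≗-from-tower f (λ k → 3 ^ k * 2) k<3^k*2 F-step S-step seed
  where
  open ≡-Reasoning
  S = shuffle (low ∘ H) (high ∘ H)
  F≗fF = f^ω.isFixedPoint⇒≗apply∞ F-fixed
  H≗hH = h^ω.isFixedPoint⇒≗apply∞ H-fixed

  k<3^k*2 : ∀ k → k < 3 ^ k * 2
  k<3^k*2 k = <-≤-trans (n<3^n k) (m≤m*n (3 ^ k) 2)

  F-step : ∀ k → apply f (prefix F (3 ^ k * 2)) ≡ prefix F (3 ^ suc k * 2)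
  F-step k = trans (f^ω.prefix-apply F≗fF (3 ^ k * 2)) (cong (prefix F) (reorder (3 ^ k)))
    where
    reorder : ∀ m → m * 2 * 3 ≡ 3 * m * 2
    reorder = solve-∀

  S-step : ∀ k → apply f (prefix S (3 ^ k * 2)) ≡ prefix S (3 ^ suc k * 2)
  S-step k = begin
    apply f (prefix S (m * 2))          ≡⟨ cong (apply f) (prefix-shuffle low high H m) ⟩
    apply f (apply bits (prefix H m))   ≡⟨ apply-intertwine f h bits f-bits≡bits-h (prefix H m) ⟩
    apply bits (apply h (prefix H m))   ≡⟨ cong (apply bits) (h^ω.prefix-apply H≗hH m) ⟩
    apply bits (prefix H (m * 3))       ≡⟨ prefix-shuffle low high H (m * 3) ⟨
    prefix S (m * 3 * 2)                ≡⟨ cong (λ n → prefix S (n * 2)) (*-comm m 3) ⟩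
    prefix S (3 * m * 2)                ∎
    where m = 3 ^ k

  seed : prefix F 2 ≡ prefix S 2
  seed = cong₂ (λ x y → x ∷ y ∷ []) (trans F0≡0 (cong low (sym H0≡0))) (trans F1≡0 (cong high (sym H0≡0)))
    where
    F0≡0 : F 0 ≡ 𝟎
    F0≡0 = ∷-injectiveˡ (F-fixed 0)
    H0≡0 : H 0 ≡ 𝟎
    H0≡0 = ∷-injectiveˡ (H-fixed 0)
    F1≡0 : F 1 ≡ 𝟎
    F1≡0 = trans (F≗fF 1) (cong (λ x → lookup (fV x) 𝟏) F0≡0)

lemma14 : Σ (Word Σ₂) (IsFixedPoint f 𝟎)
    × Σ (Word Σ₄) (IsFixedPoint h 𝟎)
    × ((F : Word Σ₂) (H : Word Σ₄) → IsFixedPoint f 𝟎 F → IsFixedPoint h 𝟎 H →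
        (n : ℕ) → F n ≡ shuffle (apply∞ g₂ H) (apply∞ g₁ H) n)
lemma14 = (f^ω.Construction.fixedWord refl , f^ω.Construction.fixedWord-isFixedPoint refl)
        , (h^ω.Construction.fixedWord refl , h^ω.Construction.fixedWord-isFixedPoint refl)
        , λ F H F-fixed H-fixed n →
            let H≗hH = h^ω.isFixedPoint⇒≗apply∞ H-fixed in
            trans (f^ω≗shuffle-h^ω F-fixed H-fixed n)
                  (shuffle-cong (apply∞-factor hV low g₂ g₂≡low-h H≗hH)
                                (apply∞-factor hV high g₁ g₁≡high-h H≗hH) n)
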